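{- Let $L\subseteq\{0,\dots,a-1\}$. Then for every $\sigma\in C_a\wr S_n$, $des_L(\sigma)\ge\overleftarrow{\min}_L(\sigma)$.
   Context: Let $\alpha=e^{2\pi i/a}$. Elements of $C_a\wr S_n$ are colored permutations $\sigma=[\sigma(1),\dots,\sigma(n)]$ with $\sigma(j)=\alpha^{t_j}|\sigma(j)|$, $|\sigma(j)|\in\{1,\dots,n\}$, $|\sigma|=[|\sigma(1)|,\dots,|\sigma(n)|]\in S_n$, and $\sigma(0)=0$. $\overleftarrow{\min}_L(\sigma)$ is the number of values $|\sigma(i)|$ which are right-to-left minima of $|\sigma|$ (i.e. $|\sigma(i)|<|\sigma(j)|$ for all $j>i$) and whose color $\alpha^{t_i}$ has $t_i\in L$. With $U$ the complement of $L$, the order $<_L$ on $\{\alpha^vj\}\cup\{0\}$: $\alpha^vj<_L0$ for $v\in L$, $\alpha^vj>_L0$ for $v\in U$; for $u,v\in L$, $i\ne j$: $\alpha^vi<_L\alpha^uj$ iff $i>j$; for $u,v\in U$, $i\ne j$: $\alpha^vi<_L\alpha^uj$ iff $i<j$; ties with equal $j$ broken arbitrarily. $des_L(\sigma)=\#\{0\le i\le n-1:\sigma(i)>_L\sigma(i+1)\}$. -}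

module Defs where

open import Data.Nat using (ℕ; zero; suc; _+_)
open import Data.Bool using (Bool; true; false; _∧_; not; if_then_else_)
open import Data.Fin using (Fin; _<_)
open import Data.Fin.Properties using (_<?_)
open import Data.Fin.Subset using (Subset; _∈_; _∉_)
open import Data.Fin.Subset.Properties using (_∈?_)
open import Data.Fin.Permutation using (Permutation′; _⟨$⟩ʳ_)
open import Data.List using (List; []; _∷_; map; allFin; length; filter)
open import Data.Bool.ListAction using (all)
open import Relation.Nullary using (does)

-- An element of C_a ≀ S_n: an underlying permutation |σ| of {1..n}
-- (encoded on Fin n, which preserves the order) together with a colour
-- exponent t_j ∈ {0..a-1} for each position j.
record ColPerm (a n : ℕ) : Set where
  constructor colPerm
  field
    perm  : Permutation′ n
    color : Fin n → Fin a

open ColPerm public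

-- Letters: 0, or α^v j  (colour exponent v, absolute value j).
data Letter (a n : ℕ) : Set where
  zeroL : Letter a n
  colL  : Fin a → Fin n → Letter a n

-- For two coloured letters with the same
-- absolute value and colours on the same side of 0 the paper breaks the tie
-- arbitrarily; we choose "false".  Such pairs never occur as adjacent
-- letters of a coloured permutation, so this choice is immaterial.
ltL : ∀ {a n} → Subset a → Letter a n → Letter a n → Bool
ltL L zeroL      zeroL      = false
ltL L (colL v i) zeroL      = does (v ∈? L)
ltL L zeroL      (colL u j) = not (does (u ∈? L))
ltL L (colL v i) (colL u j) with does (v ∈? L) | does (u ∈? L)
... | true  | true  = does (j <? i)
... | false | false = does (i <? j)
... | true  | false = true
... | false | true  = false

countDes : ∀ {a n} → Subset a → List (Letter a n) → ℕ
countDes L []           = 0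
countDes L (x ∷ [])     = 0
countDes L (x ∷ y ∷ ws) =
  (if ltL L y x then 1 else 0) + countDes L (y ∷ ws)

word : ∀ {a n} → ColPerm a n → List (Letter a n)
word {a} {n} σ = zeroL ∷ map (λ i → colL (color σ i) (perm σ ⟨$⟩ʳ i)) (allFin n)

desL : ∀ {a n} → Subset a → ColPerm a n → ℕ
desL L σ = countDes L (word σ)

isRLmin : ∀ {n} → Permutation′ n → Fin n → Bool
isRLmin {n} π i =
  all (λ j → if does (i <? j) then does ((π ⟨$⟩ʳ i) <? (π ⟨$⟩ʳ j)) else true)
      (allFin n)

rlminL : ∀ {a n} → Subset a → ColPerm a n → ℕ
rlminL {a} {n} L σ =
  length (filter (λ i → (isRLmin (perm σ) i ∧ does (color σ i ∈? L)) Data.Bool.≟ true)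
                 (allFin n))

-- Send 0 to 0, α^v j to -(1+j) for v ∈ L and to 1+j for v ∉ L: this turns <_L into
-- the order of ℤ, so des_L σ counts the descents of the key sequence 0, k₁, …, kₙ.
-- The L-coloured right-to-left minima have negative keys which decrease from left
-- to right. Between two consecutive such positions (or between 0 and the first)
-- the sequence drops, so each of them is charged a distinct descent.

module Submission where

open import Defs
open import Data.Nat using (ℕ; _≥_)
open import Data.Fin.Subset using (Subset)

open import Data.Nat using (suc; _+_; _≤_; z≤n; s≤s; z<s; s<s)
open import Data.Nat.Properties using (≤-refl; ≤-trans; <ᵇ⇒<; +-monoˡ-≤; +-assoc; module ≤-Reasoning)
open import Data.Integer using (ℤ; +_; -[1+_]; _<_; -<-; -<+; +<+)
open import Data.Integer.Properties using (_<?_; <-irrefl; <-≤-trans; ≮⇒≥)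
open import Data.Bool using (true; _∧_; if_then_else_; _≟_)
open import Data.Bool.Properties using (T-≡; ∧-conicalˡ; ∧-conicalʳ)
open import Data.Fin as Fin using (Fin; toℕ)
import Data.Fin.Properties as Fin
open import Data.Fin.Subset.Properties using (_∈?_)
open import Data.Fin.Permutation using (Permutation′; _⟨$⟩ʳ_)
open import Data.List using (List; []; _∷_; map; allFin; length; filter)
open import Data.List.Properties using (map-∘)
open import Data.List.Membership.Propositional.Properties using (∈-allFin)
open import Data.List.Relation.Unary.All as All using (All; _∷_)
open import Data.List.Relation.Unary.All.Properties using (all⁺; tabulate⁺)
open import Data.List.Relation.Unary.AllPairs using (AllPairs; _∷_)
open import Data.List.Relation.Unary.AllPairs.Properties using (tabulate⁺-<)
open import Function using (_∘_; mk⇔; Equivalence)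
open import Relation.Nullary using (yes; no; does; contradiction)
open import Relation.Nullary.Decidable using (dec-true; dec-false; does-⇔)
open import Relation.Unary using (Decidable)
open import Relation.Binary.PropositionalEquality using (_≡_; refl; sym; trans; cong; cong₂; subst)

descent : ℤ → ℤ → ℕ
descent x y = if does (y <? x) then 1 else 0

descents : List ℤ → ℕ
descents []           = 0
descents (x ∷ [])     = 0
descents (x ∷ y ∷ ys) = descent x y + descents (y ∷ ys)

descent-≤-via : ∀ x y z → descent x y ≤ descent x z + descent z y
descent-≤-via x y z with y <? x | z <? x | y <? z
... | no _    | _       | _       = z≤n
... | yes _   | yes _   | _       = s≤s z≤n
... | yes _   | no _    | yes _   = ≤-refl
... | yes y<x | no z≮x  | no y≮z  = contradiction (<-≤-trans y<x (≮⇒≥ z≮x)) y≮z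

descents-insert : ∀ x z ys → descents (x ∷ ys) ≤ descents (x ∷ z ∷ ys)
descents-insert x z []       = z≤n
descents-insert x z (y ∷ ys) = begin
  descent x y + descents (y ∷ ys)                   ≤⟨ +-monoˡ-≤ _ (descent-≤-via x y z) ⟩
  descent x z + descent z y + descents (y ∷ ys)     ≡⟨ +-assoc (descent x z) _ _ ⟩
  descent x z + (descent z y + descents (y ∷ ys))   ∎
  where open ≤-Reasoning

module _ {A : Set} {P : A → Set} (P? : Decidable P) (k : A → ℤ) where

  marked-≤-descents : ∀ x xs →
    All (λ y → P y → k y < x) xs →
    AllPairs (λ y z → P y → P z → k z < k y) xs →
    length (filter P? xs) ≤ descents (x ∷ map k xs)
  marked-≤-descents x []       _              _           = z≤n
  marked-≤-descents x (z ∷ xs) (z<x ∷ xs<x) (z>xs ∷ xs↓) with P? z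
  ... | yes Pz rewrite dec-true (k z <? x) (z<x Pz) =
    s≤s (marked-≤-descents (k z) xs (All.map (λ z>y → z>y Pz) z>xs) xs↓)
  ... | no _ =
    ≤-trans (marked-≤-descents x xs xs<x xs↓) (descents-insert x (k z) (map k xs))

module _ {a n : ℕ} (L : Subset a) where

  key : Letter a n → ℤ
  key zeroL      = + 0
  key (colL v j) = if does (v ∈? L) then -[1+ toℕ j ] else + suc (toℕ j)

  ltL≡key<? : ∀ x y → ltL L x y ≡ does (key x <? key y)
  ltL≡key<? zeroL      zeroL      = sym (dec-false (+ 0 <? + 0) (<-irrefl refl))
  ltL≡key<? (colL v i) zeroL      with v ∈? L
  ... | yes _ = sym (dec-true (-[1+ toℕ i ] <? + 0) -<+)
  ... | no _  = sym (dec-false (+ suc (toℕ i) <? + 0) λ { (+<+ ()) })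
  ltL≡key<? zeroL      (colL u j) with u ∈? L
  ... | yes _ = sym (dec-false (+ 0 <? -[1+ toℕ j ]) λ ())
  ... | no _  = sym (dec-true (+ 0 <? + suc (toℕ j)) (+<+ z<s))
  ltL≡key<? (colL v i) (colL u j) with v ∈? L | u ∈? L
  ... | yes _ | yes _ = does-⇔ (mk⇔ -<- λ { (-<- j<i) → j<i }) (j Fin.<? i) (_ <? _)
  ... | no _  | no _  = does-⇔ (mk⇔ (+<+ ∘ s<s) λ { (+<+ (s<s i<j)) → i<j }) (i Fin.<? j) (_ <? _)
  ... | yes _ | no _  = sym (dec-true (-[1+ toℕ i ] <? + suc (toℕ j)) -<+)
  ... | no _  | yes _ = sym (dec-false (+ suc (toℕ i) <? -[1+ toℕ j ]) λ ())

  countDes≡descents : ∀ ws → countDes L ws ≡ descents (map key ws)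
  countDes≡descents []           = refl
  countDes≡descents (x ∷ [])     = refl
  countDes≡descents (x ∷ y ∷ ws) =
    cong₂ _+_ (cong (if_then 1 else 0) (ltL≡key<? y x)) (countDes≡descents (y ∷ ws))

  key-∈ : ∀ v (j : Fin n) → does (v ∈? L) ≡ true → key (colL v j) ≡ -[1+ toℕ j ]
  key-∈ v j v∈L rewrite v∈L = refl

isRLmin⇒< : ∀ {n} (π : Permutation′ n) {i j : Fin n} →
            isRLmin π i ≡ true → i Fin.< j → π ⟨$⟩ʳ i Fin.< π ⟨$⟩ʳ j
isRLmin⇒< {n} π {i} {j} rl i<j
  with All.lookup (all⁺ _ (allFin n) (Equivalence.from T-≡ rl)) (∈-allFin j)
... | i⋯j rewrite dec-true (i Fin.<? j) i<j = <ᵇ⇒< _ _ i⋯j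

module _ {a n : ℕ} (L : Subset a) (σ : ColPerm a n) where

  letter : Fin n → Letter a n
  letter i = colL (color σ i) (perm σ ⟨$⟩ʳ i)

  Marked : Fin n → Set
  Marked i = (isRLmin (perm σ) i ∧ does (color σ i ∈? L)) ≡ true

  marked? : Decidable Marked
  marked? i = (isRLmin (perm σ) i ∧ does (color σ i ∈? L)) ≟ true

  marked⇒isRLmin : ∀ {i} → Marked i → isRLmin (perm σ) i ≡ true
  marked⇒isRLmin {i} = ∧-conicalˡ (isRLmin (perm σ) i) _

  marked⇒key : ∀ {i} → Marked i → key L (letter i) ≡ -[1+ toℕ (perm σ ⟨$⟩ʳ i) ]
  marked⇒key {i} m = key-∈ L (color σ i) (perm σ ⟨$⟩ʳ i) (∧-conicalʳ (isRLmin (perm σ) i) _ m)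

  desL≡descents : desL L σ ≡ descents (+ 0 ∷ map (key L ∘ letter) (allFin n))
  desL≡descents = trans (countDes≡descents L (word σ))
                        (cong (λ ks → descents (+ 0 ∷ ks)) (sym (map-∘ (allFin n))))

  marked⇒key<0 : ∀ i → Marked i → key L (letter i) < + 0
  marked⇒key<0 i m rewrite marked⇒key m = -<+

  marked⇒key-decreasing : ∀ {i j} → i Fin.< j → Marked i → Marked j →
                          key L (letter j) < key L (letter i)
  marked⇒key-decreasing {i} {j} i<j mi mj
    rewrite marked⇒key mi | marked⇒key mj
    = -<- (isRLmin⇒< (perm σ) (marked⇒isRLmin mi) i<j)

lemma4p10 : ∀ (a n : ℕ) (L : Subset a) (σ : ColPerm a n) → desL L σ ≥ rlminL L σ
lemma4p10 a n L σ = subst (rlminL L σ ≤_) (sym (desL≡descents L σ))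
  (marked-≤-descents (marked? L σ) (key L ∘ letter L σ) (+ 0) (allFin n)
    (tabulate⁺ (marked⇒key<0 L σ))
    (tabulate⁺-< (marked⇒key-decreasing L σ)))
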